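{- Let $\mathbb{F}$ be a finite field, $n_1,\dots,n_d$ positive integers, let $Q$ be an $l$-system and let $Q'$ be an $l'$-system (in $\mathbb{F}^{n_1}\otimes\dots\otimes\mathbb{F}^{n_d}$). Then $Q\cap Q'$ contains an $(l+l')$-system.
   Context: An $l$-system is defined as follows. Suppose $U\subset\mathbb{F}^{n_1}$ is a subspace of codimension at most $l$, and for every $2\le k\le d$ and every $u_1\in U,u_2\in U_{u_1},\dots,u_{k-1}\in U_{u_1,\dots,u_{k-2}}$ there is a subspace $U_{u_1,\dots,u_{k-1}}\subset\mathbb{F}^{n_k}$ of codimension at most $l$ (with $U_{u_1,\dots,u_{k-2}}$ meaning $U$ when $k=2$). Then the multiset $\{u_1\otimes\dots\otimes u_d: u_1\in U,u_2\in U_{u_1},\dots,u_d\in U_{u_1,\dots,u_{d-1}}\}$ is an $l$-system. -}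

module Defs where

open import Level using (0ℓ)
open import Data.Nat using (ℕ; zero; suc)
open import Data.Fin using (Fin)
open import Data.Bool using (Bool; T)
open import Data.Unit using (⊤; tt)
open import Data.Product using (Σ; ∃; _×_; _,_)
open import Data.List using (List; []; _∷_)
open import Data.Vec using (Vec; []; _∷_; lookup; zipWith; replicate; map)
open import Relation.Nullary using (¬_)
open import Relation.Binary.PropositionalEquality using (_≡_)
open import Algebra.Structures using (IsCommutativeRing)
open import Function.Bundles using (_↔_)
open import Function.Definitions using (Injective)

record FiniteField : Set₁ where
  field
    F   : Set
    _+_ : F → F → F
    _*_ : F → F → F
    -_  : F → F
    0#  : F
    1#  : F
    isCommutativeRing : IsCommutativeRing _≡_ _+_ _*_ -_ 0# 1#
    0≢1     : ¬ (0# ≡ 1#)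
    inverse : ∀ x → ¬ (x ≡ 0#) → ∃ λ y → (x * y) ≡ 1#
    size    : ℕ
    finite  : F ↔ Fin size

module _ (𝔽 : FiniteField) where
  open FiniteField 𝔽

  _⊕_ : ∀ {n} → Vec F n → Vec F n → Vec F n
  _⊕_ = zipWith _+_

  _·_ : ∀ {n} → F → Vec F n → Vec F n
  c · v = map (c *_) v

  𝟘 : ∀ {n} → Vec F n
  𝟘 = replicate _ 0#

  lincomb : ∀ {n l} → Vec F l → Vec (Vec F n) l → Vec F n
  lincomb []       []       = 𝟘
  lincomb (c ∷ cs) (w ∷ ws) = (c · w) ⊕ lincomb cs ws

  record Subspace (n : ℕ) : Set where
    field
      mem    : Vec F n → Bool
      0∈     : T (mem 𝟘)
      +-closed : ∀ u v → T (mem u) → T (mem v) → T (mem (u ⊕ v))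
      ·-closed : ∀ c u → T (mem u) → T (mem (c · u))

  _∈_ : ∀ {n} → Vec F n → Subspace n → Set
  u ∈ U = T (Subspace.mem U u)

  -- codim U ≤ l : the quotient F^n / U is spanned by (the images of) l vectors,
  -- i.e. dim (F^n / U) ≤ l.
  CodimAtMost : ∀ {n} → ℕ → Subspace n → Set
  CodimAtMost {n} l U =
    Σ (Vec (Vec F n) l) λ ws → ∀ (x : Vec F n) →
      Σ (Vec F l) λ cs → Σ (Vec F n) λ u → (u ∈ U) × (x ≡ (u ⊕ lincomb cs ws))

  -- The data of an l-system in F^{n_1} ⊗ ... ⊗ F^{n_d}, ns = n_1 ∷ ... ∷ n_d:
  -- a subspace U ⊆ F^{n_1} of codimension ≤ l and, for each u₁ ∈ U,
  -- the data of an l-system for the remaining factors.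
  System : ℕ → List ℕ → Set
  System l []       = ⊤
  System l (n ∷ ns) =
    Σ (Subspace n) λ U → CodimAtMost l U × ((u : Vec F n) → u ∈ U → System l ns)

  -- index set of the multiset: tuples (u₁, …, u_d) with u₁ ∈ U, u₂ ∈ U_{u₁}, …
  Path : ∀ {l} ns → System l ns → Set
  Path []       _           = ⊤
  Path (n ∷ ns) (U , _ , S) = Σ (Vec F n) λ u → Σ (u ∈ U) λ p → Path ns (S u p)

  Index : List ℕ → Set
  Index []       = ⊤
  Index (n ∷ ns) = Fin n × Index ns

  Tensor : List ℕ → Set
  Tensor ns = Index ns → F

  -- the element u₁ ⊗ … ⊗ u_d of the multiset attached to a path
  tensorOf : ∀ {l} ns (S : System l ns) → Path ns S → Tensor ns
  tensorOf []       _           _             _          = 1#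
  tensorOf (n ∷ ns) (U , _ , S) (u , p , rest) (i , is) =
    lookup u i * tensorOf ns (S u p) rest is

  -- multiset inclusion: the multiset of R is a sub-multiset of that of Q,
  -- i.e. an injection of index sets preserving the tensor
  _⊆ₘ_ : ∀ {l l'} {ns} → System l ns → System l' ns → Set
  _⊆ₘ_ {ns = ns} R Q =
    Σ (Path ns R → Path ns Q) λ f →
      Injective _≡_ _≡_ f ×
      (∀ p (i : Index ns) → tensorOf ns Q (f p) i ≡ tensorOf ns R p i)

-- The l-system Q and the l′-system Q′ are intersected level by level: the
-- first subspace is U ∩ U′, and above a vector u of U ∩ U′ sits the
-- intersection of the two subsystems above u (intersect).  Two facts make this
-- an (l + l′)-system contained in both.
--
--  * Linear algebra (codim-⊓): codim (U ∩ U′) ≤ codim U + codim U′.  Writing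
--    B +⟨ ws ⟩ for {b + Σ cᵢ wᵢ : b ∈ B}, the exchange lemma turns U′ ⊆ U +⟨ws⟩
--    (|ws| = l) into U′ ⊆ U +⟨zs⟩ with l vectors zs of U′ itself; hence
--    U′ ⊆ (U ∩ U′) +⟨zs⟩, and composing with F^n = U′ +⟨ws′⟩ gives
--    F^n = (U ∩ U′) +⟨zs ++ ws′⟩.  Choosing the vector to exchange uses an
--    exhaustive search of F^n, which is where finiteness of F enters.
--
--  * Combinatorics of systems (refines⇒⊆ₘ): if every subspace of R lies in the
--    corresponding subspace of Q, the paths of R are paths of Q with the same
--    tensors, so the multiset of R is a sub-multiset of that of Q.
module Submission where

open import Defs
open import Level using (0ℓ)
open import Data.Nat using (ℕ; zero; suc; _+_; _≤_)
open import Data.List using (List; []; _∷_)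
open import Data.List.Relation.Unary.All using (All)
open import Data.Product using (Σ; ∃; _×_; _,_; proj₁; proj₂)
open import Data.Product.Properties using (,-injectiveʳ-UIP)
open import Data.Bool using (T; _∧_)
open import Data.Bool.Properties using (T?; T-∧; T-irrelevant)
open import Data.Unit using (⊤; tt)
open import Data.Fin.Properties using (any?; inj⇒≟)
open import Data.Vec using (Vec; []; _∷_; _++_; head; lookup)
open import Data.Vec.Properties using (≡-dec)
import Data.Vec.Relation.Unary.All as Vec
open import Algebra.Bundles using (CommutativeRing)
import Algebra.Properties.Ring as RingProperties
open import Algebra.Structures using (IsCommutativeRing)
open import Function using (_∘_)
open import Function.Bundles using (Inverse; Equivalence)
open import Function.Properties.Inverse using (↔⇒↣)
open import Axiom.UniquenessOfIdentityProofs using (UIP; module Decidable⇒UIP)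
open import Relation.Nullary using (¬_; Dec; yes; no)
open import Relation.Nullary.Decidable using (map′; decidable-stable)
open import Relation.Unary using (Pred; _⊆_; _∩_; Decidable)
open import Relation.Binary.Definitions using (DecidableEquality)
open import Relation.Binary.PropositionalEquality

module _ (𝔽 : FiniteField) where
  open FiniteField 𝔽 using (F; isCommutativeRing; inverse; finite)
  open Inverse finite using (to; from; strictlyInverseʳ)
  open IsCommutativeRing isCommutativeRing
    using (+-assoc; +-identityˡ; +-identityʳ; *-identityʳ; zeroˡ; zeroʳ; -‿inverseˡ; -‿inverseʳ)

  F-ring : CommutativeRing 0ℓ 0ℓ
  F-ring = record { isCommutativeRing = isCommutativeRing }

  open CommutativeRing F-ring using (commutativeSemiring)
    renaming (_+_ to _+ᶠ_; _*_ to _*ᶠ_; -_ to -ᶠ_; 0# to 0ᶠ; 1# to 1ᶠ)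
  open RingProperties (CommutativeRing.ring F-ring) using (-1*x≈-x)
  open import Algebra.Solver.Ring.NaturalCoefficients.Default commutativeSemiring
    using (solve; _:=_; _:+_; _:*_)

  _≟ᶠ_ : DecidableEquality F
  _≟ᶠ_ = inj⇒≟ (↔⇒↣ finite)

  V : ℕ → Set
  V n = Vec F n

  infixl 6 _⊞_
  infixr 7 _⊡_

  _⊞_ : ∀ {n} → V n → V n → V n
  _⊞_ = _⊕_ 𝔽

  _⊡_ : ∀ {n} → F → V n → V n
  _⊡_ = _·_ 𝔽

  𝟎 : ∀ {n} → V n
  𝟎 = 𝟘 𝔽

  lc : ∀ {n k} → Vec F k → Vec (V n) k → V n
  lc = lincomb 𝔽

  ⊞-identityˡ : ∀ {n} (y : V n) → 𝟎 ⊞ y ≡ y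
  ⊞-identityˡ []       = refl
  ⊞-identityˡ (y ∷ ys) = cong₂ _∷_ (+-identityˡ y) (⊞-identityˡ ys)

  ⊞-assoc : ∀ {n} (x y z : V n) → (x ⊞ y) ⊞ z ≡ x ⊞ (y ⊞ z)
  ⊞-assoc []       []       []       = refl
  ⊞-assoc (x ∷ xs) (y ∷ ys) (z ∷ zs) = cong₂ _∷_ (law x y z) (⊞-assoc xs ys zs)
    where
    law : ∀ x y z → (x +ᶠ y) +ᶠ z ≡ x +ᶠ (y +ᶠ z)
    law = solve 3 (λ x y z → ((x :+ y) :+ z) := (x :+ (y :+ z))) refl

  zero-⊡-⊞ : ∀ {n} (w y : V n) → 0ᶠ ⊡ w ⊞ y ≡ y
  zero-⊡-⊞ []       []       = refl
  zero-⊡-⊞ (w ∷ ws) (y ∷ ys) = cong₂ _∷_ (law w y) (zero-⊡-⊞ ws ys)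
    where
    law : ∀ w y → 0ᶠ *ᶠ w +ᶠ y ≡ y
    law w y = trans (cong (_+ᶠ y) (zeroˡ w)) (+-identityˡ y)

  -- Used to show that y lies in a subspace containing y + z and z.
  ⊞-cancel : ∀ {n} (y z : V n) → (y ⊞ z) ⊞ (-ᶠ 1ᶠ) ⊡ z ≡ y
  ⊞-cancel []       []       = refl
  ⊞-cancel (y ∷ ys) (z ∷ zs) = cong₂ _∷_ (law y z) (⊞-cancel ys zs)
    where
    law : ∀ y z → (y +ᶠ z) +ᶠ (-ᶠ 1ᶠ) *ᶠ z ≡ y
    law y z = begin
      (y +ᶠ z) +ᶠ (-ᶠ 1ᶠ) *ᶠ z  ≡⟨ cong ((y +ᶠ z) +ᶠ_) (-1*x≈-x z) ⟩
      (y +ᶠ z) +ᶠ -ᶠ z          ≡⟨ +-assoc y z (-ᶠ z) ⟩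
      y +ᶠ (z +ᶠ -ᶠ z)          ≡⟨ cong (y +ᶠ_) (-‿inverseʳ z) ⟩
      y +ᶠ 0ᶠ                   ≡⟨ +-identityʳ y ⟩
      y                          ∎
      where open ≡-Reasoning

  -- Used to show that B + ⟨as⟩ is closed under y + t z.
  ⊞-interchange : ∀ {n} t (p q r s : V n) → (p ⊞ q) ⊞ t ⊡ (r ⊞ s) ≡ (p ⊞ t ⊡ r) ⊞ (q ⊞ t ⊡ s)
  ⊞-interchange t []       []       []       []       = refl
  ⊞-interchange t (p ∷ ps) (q ∷ qs) (r ∷ rs) (s ∷ ss) = cong₂ _∷_ (law t p q r s) (⊞-interchange t ps qs rs ss)
    where
    law : ∀ t p q r s → (p +ᶠ q) +ᶠ t *ᶠ (r +ᶠ s) ≡ (p +ᶠ t *ᶠ r) +ᶠ (q +ᶠ t *ᶠ s)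
    law = solve 5 (λ t p q r s → ((p :+ q) :+ t :* (r :+ s)) := ((p :+ t :* r) :+ (q :+ t :* s))) refl

  lc-combine : ∀ {n k} t (cs ds : Vec F k) (ws : Vec (V n) k) → lc (cs ⊞ t ⊡ ds) ws ≡ lc cs ws ⊞ t ⊡ lc ds ws
  lc-combine t [] [] [] = 𝟎≡𝟎⊞t⊡𝟎
    where
    𝟎≡𝟎⊞t⊡𝟎 : ∀ {n} → 𝟎 {n} ≡ 𝟎 ⊞ t ⊡ 𝟎
    𝟎≡𝟎⊞t⊡𝟎 {zero}  = refl
    𝟎≡𝟎⊞t⊡𝟎 {suc n} = cong₂ _∷_ (sym (trans (cong (0ᶠ +ᶠ_) (zeroʳ t)) (+-identityʳ 0ᶠ))) 𝟎≡𝟎⊞t⊡𝟎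
  lc-combine t (c ∷ cs) (d ∷ ds) (w ∷ ws) = begin
    (c +ᶠ t *ᶠ d) ⊡ w ⊞ lc (cs ⊞ t ⊡ ds) ws      ≡⟨ cong ((c +ᶠ t *ᶠ d) ⊡ w ⊞_) (lc-combine t cs ds ws) ⟩
    (c +ᶠ t *ᶠ d) ⊡ w ⊞ (lc cs ws ⊞ t ⊡ lc ds ws) ≡⟨ distrib w (lc cs ws) (lc ds ws) ⟩
    (c ⊡ w ⊞ lc cs ws) ⊞ t ⊡ (d ⊡ w ⊞ lc ds ws)   ∎
    where
    open ≡-Reasoning
    law : ∀ c d t w x y → (c +ᶠ t *ᶠ d) *ᶠ w +ᶠ (x +ᶠ t *ᶠ y) ≡ (c *ᶠ w +ᶠ x) +ᶠ t *ᶠ (d *ᶠ w +ᶠ y)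
    law = solve 6 (λ c d t w x y → ((c :+ t :* d) :* w :+ (x :+ t :* y)) := ((c :* w :+ x) :+ t :* (d :* w :+ y))) refl
    distrib : ∀ {n} (w x y : V n) → (c +ᶠ t *ᶠ d) ⊡ w ⊞ (x ⊞ t ⊡ y) ≡ (c ⊡ w ⊞ x) ⊞ t ⊡ (d ⊡ w ⊞ y)
    distrib []       []       []       = refl
    distrib (w ∷ ws) (x ∷ xs) (y ∷ ys) = cong₂ _∷_ (law c d t w x y) (distrib ws xs ys)

  lc-++ : ∀ {n k m} (cs : Vec F k) (ds : Vec F m) (ws : Vec (V n) k) (zs : Vec (V n) m) →
          lc (cs ++ ds) (ws ++ zs) ≡ lc cs ws ⊞ lc ds zs
  lc-++ []       ds []       zs = sym (⊞-identityˡ (lc ds zs))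
  lc-++ (c ∷ cs) ds (w ∷ ws) zs = trans (cong (c ⊡ w ⊞_) (lc-++ cs ds ws zs)) (sym (⊞-assoc (c ⊡ w) (lc cs ws) (lc ds zs)))

  -- The exchange identity: if a = b₀ + (c w + L₀) and d = s c, then
  -- b + (d w + L) = (b - s b₀) + s a + (L - s L₀), which trades w for a.
  exchange-identity : ∀ {n} s c (b b₀ w L L₀ : V n) →
    b ⊞ ((s *ᶠ c) ⊡ w ⊞ L) ≡ ((b ⊞ (-ᶠ s) ⊡ b₀) ⊞ (s ⊡ (b₀ ⊞ (c ⊡ w ⊞ L₀)) ⊞ 𝟎)) ⊞ (L ⊞ (-ᶠ s) ⊡ L₀)
  exchange-identity s c []       []         []       []       []         = refl
  exchange-identity s c (b ∷ bs) (b₀ ∷ b₀s) (w ∷ ws) (L ∷ Ls) (L₀ ∷ L₀s) =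
    cong₂ _∷_ (law b b₀ w L L₀) (exchange-identity s c bs b₀s ws Ls L₀s)
    where
    open ≡-Reasoning
    -- with t standing for -s, both sides agree up to the term (t + s)(b₀ + L₀)
    regroup : ∀ b b₀ w L L₀ s c t z →
      ((b +ᶠ t *ᶠ b₀) +ᶠ (s *ᶠ (b₀ +ᶠ (c *ᶠ w +ᶠ L₀)) +ᶠ z)) +ᶠ (L +ᶠ t *ᶠ L₀)
      ≡ (b +ᶠ ((s *ᶠ c) *ᶠ w +ᶠ L)) +ᶠ ((t +ᶠ s) *ᶠ (b₀ +ᶠ L₀) +ᶠ z)
    regroup = solve 9 (λ b b₀ w L L₀ s c t z →
      (((b :+ t :* b₀) :+ (s :* (b₀ :+ (c :* w :+ L₀)) :+ z)) :+ (L :+ t :* L₀))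
      := ((b :+ ((s :* c) :* w :+ L)) :+ ((t :+ s) :* (b₀ :+ L₀) :+ z))) refl
    law : ∀ b b₀ w L L₀ → b +ᶠ ((s *ᶠ c) *ᶠ w +ᶠ L)
        ≡ ((b +ᶠ (-ᶠ s) *ᶠ b₀) +ᶠ (s *ᶠ (b₀ +ᶠ (c *ᶠ w +ᶠ L₀)) +ᶠ 0ᶠ)) +ᶠ (L +ᶠ (-ᶠ s) *ᶠ L₀)
    law b b₀ w L L₀ = sym (begin
      ((b +ᶠ (-ᶠ s) *ᶠ b₀) +ᶠ (s *ᶠ (b₀ +ᶠ (c *ᶠ w +ᶠ L₀)) +ᶠ 0ᶠ)) +ᶠ (L +ᶠ (-ᶠ s) *ᶠ L₀)
        ≡⟨ regroup b b₀ w L L₀ s c (-ᶠ s) 0ᶠ ⟩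
      x +ᶠ ((-ᶠ s +ᶠ s) *ᶠ (b₀ +ᶠ L₀) +ᶠ 0ᶠ)
        ≡⟨ cong (λ e → x +ᶠ (e *ᶠ (b₀ +ᶠ L₀) +ᶠ 0ᶠ)) (-‿inverseˡ s) ⟩
      x +ᶠ (0ᶠ *ᶠ (b₀ +ᶠ L₀) +ᶠ 0ᶠ)
        ≡⟨ cong (λ e → x +ᶠ (e +ᶠ 0ᶠ)) (zeroˡ (b₀ +ᶠ L₀)) ⟩
      x +ᶠ (0ᶠ +ᶠ 0ᶠ)
        ≡⟨ cong (x +ᶠ_) (+-identityʳ 0ᶠ) ⟩
      x +ᶠ 0ᶠ
        ≡⟨ +-identityʳ x ⟩
      x ∎)
      where
      x : F
      x = b +ᶠ ((s *ᶠ c) *ᶠ w +ᶠ L)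

  set : ∀ {n} → Subspace 𝔽 n → Pred (V n) 0ℓ
  set U x = _∈_ 𝔽 x U

  -- Closure under y + t z: all that the exchange argument needs of a "subspace".
  Closed : ∀ {n} → Pred (V n) 0ℓ → Set
  Closed B = ∀ {y z} t → B y → B z → B (y ⊞ t ⊡ z)

  subspace-closed : ∀ {n} (U : Subspace 𝔽 n) → Closed (set U)
  subspace-closed U t y∈U z∈U = Subspace.+-closed U _ _ y∈U (Subspace.·-closed U t _ z∈U)

  lc∈ : ∀ {n k} (U : Subspace 𝔽 n) (ds : Vec F k) {zs : Vec (V n) k} → Vec.All (set U) zs → set U (lc ds zs)
  lc∈ U []       Vec.[]           = Subspace.0∈ U
  lc∈ U (d ∷ ds) (z∈U Vec.∷ zs∈U) = Subspace.+-closed U _ _ (Subspace.·-closed U d _ z∈U) (lc∈ U ds zs∈U)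

  -- B +⟨ ws ⟩ : the vectors b + Σ cᵢ wᵢ with B b.  By definition,
  -- CodimAtMost l U says exactly that F^n = set U +⟨ ws ⟩ for some ws of length l.
  infixl 6 _+⟨_⟩
  _+⟨_⟩ : ∀ {n k} → Pred (V n) 0ℓ → Vec (V n) k → Pred (V n) 0ℓ
  _+⟨_⟩ {n} {k} B ws x = Σ (Vec F k) λ cs → Σ (V n) λ b → B b × x ≡ b ⊞ lc cs ws

  +⟨⟩-mono : ∀ {n k} {B B′ : Pred (V n) 0ℓ} {ws : Vec (V n) k} → B ⊆ B′ → B +⟨ ws ⟩ ⊆ B′ +⟨ ws ⟩
  +⟨⟩-mono B⊆B′ (cs , b , b∈B , eq) = cs , b , B⊆B′ b∈B , eq

  +⟨⟩-flatten : ∀ {n k m} {B : Pred (V n) 0ℓ} {as : Vec (V n) k} {zs : Vec (V n) m} →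
                B +⟨ as ⟩ +⟨ zs ⟩ ⊆ B +⟨ as ++ zs ⟩
  +⟨⟩-flatten {as = as} {zs} (ds , _ , (cs , b , b∈B , refl) , refl) =
    cs ++ ds , b , b∈B , trans (⊞-assoc b (lc cs as) (lc ds zs)) (cong (b ⊞_) (sym (lc-++ cs ds as zs)))

  +⟨⟩-closed : ∀ {n k} {B : Pred (V n) 0ℓ} {as : Vec (V n) k} → Closed B → Closed (B +⟨ as ⟩)
  +⟨⟩-closed {as = as} closed t (cs , b , b∈B , refl) (cs′ , b′ , b′∈B , refl) =
    cs ⊞ t ⊡ cs′ , b ⊞ t ⊡ b′ , closed t b∈B b′∈B ,
    trans (⊞-interchange t b (lc cs as) b′ (lc cs′ as)) (cong ((b ⊞ t ⊡ b′) ⊞_) (sym (lc-combine t cs cs′ as)))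

  drop-zero : ∀ {n k} {B : Pred (V n) 0ℓ} {w : V n} {ws : Vec (V n) k} {x} →
              (r : (B +⟨ w ∷ ws ⟩) x) → head (proj₁ r) ≡ 0ᶠ → (B +⟨ ws ⟩) x
  drop-zero {w = w} {ws} (c ∷ cs , b , b∈B , eq) refl = cs , b , b∈B , trans eq (cong (b ⊞_) (zero-⊡-⊞ w (lc cs ws)))

  add-generator : ∀ {n k} {B : Pred (V n) 0ℓ} (z : V n) {zs : Vec (V n) k} → B +⟨ zs ⟩ ⊆ B +⟨ z ∷ zs ⟩
  add-generator z {zs} (cs , b , b∈B , eq) = 0ᶠ ∷ cs , b , b∈B , trans eq (cong (b ⊞_) (sym (zero-⊡-⊞ z (lc cs zs))))

  exchange-step : ∀ {n k} {B : Pred (V n) 0ℓ} → Closed B → {w a b₀ : V n} {ws : Vec (V n) k} {c : F} {cs₀ : Vec F k} →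
    B b₀ → a ≡ b₀ ⊞ lc (c ∷ cs₀) (w ∷ ws) → ¬ c ≡ 0ᶠ → B +⟨ w ∷ ws ⟩ ⊆ B +⟨ a ∷ [] ⟩ +⟨ ws ⟩
  exchange-step closed {w} {a} {b₀} {ws} {c} {cs₀} b₀∈B refl c≢0 {x} (d ∷ ds , b , b∈B , refl) =
    ds ⊞ (-ᶠ s) ⊡ cs₀ , y , (s ∷ [] , b ⊞ (-ᶠ s) ⊡ b₀ , closed (-ᶠ s) b∈B b₀∈B , refl) , x≡
    where
    open ≡-Reasoning
    -- s = d / c, the multiple of a that replaces the w-component of x
    γ : F
    γ = proj₁ (inverse c c≢0)
    s : F
    s = d *ᶠ γ
    s*c≡d : s *ᶠ c ≡ d
    s*c≡d = begin
      (d *ᶠ γ) *ᶠ c ≡⟨ solve 3 (λ d γ c → ((d :* γ) :* c) := (d :* (c :* γ))) refl d γ c ⟩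
      d *ᶠ (c *ᶠ γ) ≡⟨ cong (d *ᶠ_) (proj₂ (inverse c c≢0)) ⟩
      d *ᶠ 1ᶠ       ≡⟨ *-identityʳ d ⟩
      d             ∎
    y : V _
    y = (b ⊞ (-ᶠ s) ⊡ b₀) ⊞ lc (s ∷ []) (a ∷ [])
    x≡ : x ≡ y ⊞ lc (ds ⊞ (-ᶠ s) ⊡ cs₀) ws
    x≡ = begin
      b ⊞ (d ⊡ w ⊞ lc ds ws)
        ≡⟨ cong (λ e → b ⊞ (e ⊡ w ⊞ lc ds ws)) (sym s*c≡d) ⟩
      b ⊞ ((s *ᶠ c) ⊡ w ⊞ lc ds ws)
        ≡⟨ exchange-identity s c b b₀ w (lc ds ws) (lc cs₀ ws) ⟩
      y ⊞ (lc ds ws ⊞ (-ᶠ s) ⊡ lc cs₀ ws)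
        ≡⟨ cong (y ⊞_) (sym (lc-combine (-ᶠ s) ds cs₀ ws)) ⟩
      y ⊞ lc (ds ⊞ (-ᶠ s) ⊡ cs₀) ws ∎

  search : ∀ n {P : Pred (V n) 0ℓ} → Decidable P → Dec (∃ P)
  search zero    P? = map′ ([] ,_) (λ { ([] , p) → p }) (P? [])
  search (suc n) {P} P? = map′ found complete (any? λ i → search n (λ xs → P? (from i ∷ xs)))
    where
    found : ∃ (λ i → ∃ λ xs → P (from i ∷ xs)) → ∃ P
    found (i , xs , p) = from i ∷ xs , p
    complete : ∃ P → ∃ (λ i → ∃ λ xs → P (from i ∷ xs))
    complete (x ∷ xs , p) = to x , xs , subst (λ y → P (y ∷ xs)) (sym (strictlyInverseʳ x)) p

  module _ {n k} (A : Subspace 𝔽 n) {B : Pred (V n) 0ℓ} {w : V n} {ws : Vec (V n) k}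
           (A⊆ : set A ⊆ B +⟨ w ∷ ws ⟩) where

    lead : ∀ {x} → set A x → F
    lead x∈A = head (proj₁ (A⊆ x∈A))

    Leads : Pred (V n) 0ℓ
    Leads x = Σ (set A x) λ x∈A → ¬ lead x∈A ≡ 0ᶠ

    leads? : Decidable Leads
    leads? x with T? (Subspace.mem A x)
    ... | no x∉A = no (x∉A ∘ proj₁)
    ... | yes x∈A with lead x∈A ≟ᶠ 0ᶠ
    ...   | no nz = yes (x∈A , nz)
    ...   | yes z = no λ (x∈A′ , nz) → nz (subst (λ p → lead p ≡ 0ᶠ) (T-irrelevant x∈A x∈A′) z)

  -- Each generator w is either traded for an element of A that uses it, or,
  -- if no element uses it, replaced by 0.
  exchange : ∀ {n k} (A : Subspace 𝔽 n) {B : Pred (V n) 0ℓ} → Closed B → (ws : Vec (V n) k) →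
             set A ⊆ B +⟨ ws ⟩ → Σ (Vec (V n) k) λ zs → Vec.All (set A) zs × set A ⊆ B +⟨ zs ⟩
  exchange A closed []       A⊆ = [] , Vec.[] , A⊆
  exchange {n} A closed (w ∷ ws) A⊆ with search n (leads? A A⊆)
  ... | no none =
          let zs , zs⊆A , A⊆′ = exchange A closed ws (λ x∈A → drop-zero (A⊆ x∈A) (lead≡0 x∈A))
          in 𝟎 ∷ zs , Subspace.0∈ A Vec.∷ zs⊆A , add-generator 𝟎 ∘ A⊆′
    where lead≡0 : ∀ {x} (x∈A : set A x) → lead A A⊆ x∈A ≡ 0ᶠ
          lead≡0 x∈A = decidable-stable (_ ≟ᶠ 0ᶠ) (λ nz → none (_ , x∈A , nz))
  ... | yes (a , a∈A , c≢0) with A⊆ a∈A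
  ...   | c ∷ cs₀ , b₀ , b₀∈B , a≡ =
          let zs , zs⊆A , A⊆′ = exchange A (+⟨⟩-closed closed) ws (exchange-step closed {cs₀ = cs₀} b₀∈B a≡ c≢0 ∘ A⊆)
          in a ∷ zs , a∈A Vec.∷ zs⊆A , +⟨⟩-flatten ∘ A⊆′

  restrict : ∀ {n k} (A : Subspace 𝔽 n) {B : Pred (V n) 0ℓ} {zs : Vec (V n) k} →
             Vec.All (set A) zs → set A ⊆ B +⟨ zs ⟩ → set A ⊆ (B ∩ set A) +⟨ zs ⟩
  restrict A {zs = zs} zs⊆A A⊆ x∈A with A⊆ x∈A
  ... | ds , b , b∈B , refl = ds , b , (b∈B , b∈A) , refl
    where
    b∈A : set A b
    b∈A = subst (set A) (⊞-cancel b (lc ds zs)) (subspace-closed A (-ᶠ 1ᶠ) x∈A (lc∈ A ds zs⊆A))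

  _⊓_ : ∀ {n} → Subspace 𝔽 n → Subspace 𝔽 n → Subspace 𝔽 n
  U ⊓ U′ = record
    { mem      = λ x → Subspace.mem U x ∧ Subspace.mem U′ x
    ; 0∈       = both (Subspace.0∈ U) (Subspace.0∈ U′)
    ; +-closed = λ u v p q → both (Subspace.+-closed U u v (fst p) (fst q)) (Subspace.+-closed U′ u v (snd p) (snd q))
    ; ·-closed = λ c u p → both (Subspace.·-closed U c u (fst p)) (Subspace.·-closed U′ c u (snd p))
    }
    where
    both : ∀ {a b} → T a → T b → T (a ∧ b)
    both p q = Equivalence.from T-∧ (p , q)
    fst : ∀ {a b} → T (a ∧ b) → T a
    fst = proj₁ ∘ Equivalence.to T-∧
    snd : ∀ {a b} → T (a ∧ b) → T b
    snd = proj₂ ∘ Equivalence.to T-∧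

  ⊓-intro : ∀ {n} {U U′ : Subspace 𝔽 n} → set U ∩ set U′ ⊆ set (U ⊓ U′)
  ⊓-intro = Equivalence.from T-∧

  ⊓-fst : ∀ {n} {U U′ : Subspace 𝔽 n} → set (U ⊓ U′) ⊆ set U
  ⊓-fst = proj₁ ∘ Equivalence.to T-∧

  ⊓-snd : ∀ {n} {U U′ : Subspace 𝔽 n} → set (U ⊓ U′) ⊆ set U′
  ⊓-snd = proj₂ ∘ Equivalence.to T-∧

  -- Exchange the l generators ws of
  -- F^n / U for vectors zs of U′; then U′ ⊆ (U ∩ U′) + ⟨zs⟩, and every vector,
  -- being in U′ + ⟨ws′⟩, lies in (U ∩ U′) + ⟨zs ++ ws′⟩.
  codim-⊓ : ∀ {n l l′} {U U′ : Subspace 𝔽 n} →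
            CodimAtMost 𝔽 l U → CodimAtMost 𝔽 l′ U′ → CodimAtMost 𝔽 (l + l′) (U ⊓ U′)
  codim-⊓ {U = U} {U′} (ws , hU) (ws′ , hU′)
    with exchange U′ (subspace-closed U) ws (λ {x} _ → hU x)
  ... | zs , zs⊆U′ , U′⊆U+zs =
        zs ++ ws′ , λ x → +⟨⟩-mono (⊓-intro {U = U} {U′}) (+⟨⟩-flatten (+⟨⟩-mono (restrict U′ zs⊆U′ U′⊆U+zs) (hU′ x)))

  Refines : ∀ {l l′} ns → System 𝔽 l ns → System 𝔽 l′ ns → Set
  Refines []       _           _            = ⊤
  Refines (n ∷ ns) (U , _ , S) (U′ , _ , S′) =
    Σ (set U ⊆ set U′) λ U⊆U′ → ∀ u (u∈U : set U u) → Refines ns (S u u∈U) (S′ u (U⊆U′ u∈U))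

  embed : ∀ {l l′} ns {R : System 𝔽 l ns} {Q : System 𝔽 l′ ns} → Refines ns R Q → Path 𝔽 ns R → Path 𝔽 ns Q
  embed []       _             _             = tt
  embed (n ∷ ns) (U⊆U′ , next) (u , u∈U , p) = u , U⊆U′ u∈U , embed ns (next u u∈U) p

  embed-tensor : ∀ {l l′} ns {R : System 𝔽 l ns} {Q : System 𝔽 l′ ns} (ρ : Refines ns R Q) p i →
                 tensorOf 𝔽 ns Q (embed ns ρ p) i ≡ tensorOf 𝔽 ns R p i
  embed-tensor []       _             _             _        = refl
  embed-tensor (n ∷ ns) (U⊆U′ , next) (u , u∈U , p) (i , is) = cong (lookup u i *ᶠ_) (embed-tensor ns (next u u∈U) p is)

  -- Paths are determined by their vectors, since membership proofs are unique.
  embed-injective : ∀ {l l′} ns {R : System 𝔽 l ns} {Q : System 𝔽 l′ ns} (ρ : Refines ns R Q) {p q} →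
                    embed ns ρ p ≡ embed ns ρ q → p ≡ q
  embed-injective []       _             {tt}          {tt}          _  = refl
  embed-injective (n ∷ ns) (U⊆U′ , next) {u , u∈U , p} {v , v∈U , q} eq with cong proj₁ eq
  ... | refl with T-irrelevant u∈U v∈U
  ...   | refl = cong (λ r → u , u∈U , r)
                   (embed-injective ns (next u u∈U) (,-injectiveʳ-UIP uip-T (,-injectiveʳ-UIP uip-V eq)))
    where
    uip-V : UIP (V n)
    uip-V = Decidable⇒UIP.≡-irrelevant (≡-dec _≟ᶠ_)
    uip-T : ∀ {b} → UIP (T b)
    uip-T = Decidable⇒UIP.≡-irrelevant (λ x y → yes (T-irrelevant x y))

  refines⇒⊆ₘ : ∀ {l l′} ns {R : System 𝔽 l ns} {Q : System 𝔽 l′ ns} → Refines ns R Q → _⊆ₘ_ 𝔽 R Q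
  refines⇒⊆ₘ ns ρ = embed ns ρ , embed-injective ns ρ , embed-tensor ns ρ

  intersect : ∀ {l l′} ns → System 𝔽 l ns → System 𝔽 l′ ns → System 𝔽 (l + l′) ns
  intersect []       _            _               = tt
  intersect (n ∷ ns) (U , cU , S) (U′ , cU′ , S′) =
    U ⊓ U′ , codim-⊓ {U = U} {U′} cU cU′ , λ u u∈ → intersect ns (S u (⊓-fst {U = U} {U′} u∈)) (S′ u (⊓-snd {U = U} {U′} u∈))

  intersect-refinesˡ : ∀ {l l′} ns (Q : System 𝔽 l ns) (Q′ : System 𝔽 l′ ns) → Refines ns (intersect ns Q Q′) Q
  intersect-refinesˡ []       _           _             = tt
  intersect-refinesˡ (n ∷ ns) (U , _ , S) (U′ , _ , S′) =
    ⊓-fst {U = U} {U′} , λ u u∈ → intersect-refinesˡ ns (S u _) (S′ u _)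

  intersect-refinesʳ : ∀ {l l′} ns (Q : System 𝔽 l ns) (Q′ : System 𝔽 l′ ns) → Refines ns (intersect ns Q Q′) Q′
  intersect-refinesʳ []       _           _             = tt
  intersect-refinesʳ (n ∷ ns) (U , _ , S) (U′ , _ , S′) =
    ⊓-snd {U = U} {U′} , λ u u∈ → intersect-refinesʳ ns (S u _) (S′ u _)

-- Lemma 2.4: Q ∩ Q′ contains an (l + l′)-system, namely the levelwise
-- intersection.
lemma2p4 : (𝔽 : FiniteField) (ns : List ℕ) → ¬ (ns ≡ []) → All (λ n → 1 ≤ n) ns →
    (l l' : ℕ) (Q : System 𝔽 l ns) (Q' : System 𝔽 l' ns) →
    Σ (System 𝔽 (l + l') ns) λ R → (_⊆ₘ_ 𝔽 R Q) × (_⊆ₘ_ 𝔽 R Q')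
lemma2p4 𝔽 ns _ _ l l' Q Q' =
  intersect 𝔽 ns Q Q' ,
  refines⇒⊆ₘ 𝔽 ns (intersect-refinesˡ 𝔽 ns Q Q') ,
  refines⇒⊆ₘ 𝔽 ns (intersect-refinesʳ 𝔽 ns Q Q')
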